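{- For all integers $n\ge 3$, \[ f(0110,n)=\left(\binom{n}{2}-\binom{n}{3}-4\right)2^{n-2}-11\binom{n}{4}+5\binom{n}{3}-2\binom{n}{2}-2n+3. \]
   Context: For $\pi=\pi_1\cdots\pi_n\in S_n$, its index is the binary string $r^\pi=r_1\cdots r_{n-1}$ with $r_i=0$ if $\pi_i<\pi_{i+1}$ and $r_i=1$ if $\pi_i>\pi_{i+1}$. For a binary string $r$ ending in $0$, $f(r,n)$ is the number of $\pi\in S_n$ whose index is $rr'$ for some binary string $r'$ containing exactly one $1$. -}

module Defs where

open import Data.Bool using (Bool; true; false; _∧_; not; if_then_else_)
open import Data.Nat using (ℕ; zero; suc; _<ᵇ_; _≡ᵇ_; _∸_)
open import Data.List using (List; []; _∷_; length; map; concatMap; upTo; filterᵇ; drop)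
open import Data.Bool.ListAction using (any)

-- A binary digit is a natural number 0 or 1; binary strings are lists of them.
BinStr : Set
BinStr = List ℕ

index : List ℕ → BinStr
index (x ∷ y ∷ xs) = (if x <ᵇ y then 0 else 1) ∷ index (y ∷ xs)
index _ = []

words : ℕ → ℕ → List (List ℕ)
words n zero = [] ∷ []
words n (suc k) = concatMap (λ w → map (λ a → a ∷ w) (upTo n)) (words n k)

distinct : List ℕ → Bool
distinct [] = true
distinct (x ∷ xs) = not (any (λ y → x ≡ᵇ y) xs) ∧ distinct xs

-- S_n, realised as the injective words of length n over {0,…,n-1}
-- (one-line notation of permutations of {0,…,n-1}, a relabelling of {1,…,n})
Sym : ℕ → List (List ℕ)
Sym n = filterᵇ distinct (words n n)

isPrefix : BinStr → BinStr → Bool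
isPrefix [] s = true
isPrefix (a ∷ r) [] = false
isPrefix (a ∷ r) (b ∷ s) = (a ≡ᵇ b) ∧ isPrefix r s

ones : BinStr → ℕ
ones [] = 0
ones (a ∷ s) = if a ≡ᵇ 1 then suc (ones s) else ones s

-- does s have the form r r' with r' a binary string containing exactly one 1?
-- (entries of an index are always 0/1, so r' is a binary string automatically)
matches : BinStr → BinStr → Bool
matches r s = isPrefix r s ∧ (ones (drop (length r) s) ≡ᵇ 1)

f : BinStr → ℕ → ℕ
f r n = length (filterᵇ (λ π → matches r (index π)) (Sym n))

-- A permutation of {0,…,m} is its first letter j followed by a permutation σ of {0,…,m-1} whose
-- letters ≥ j are shifted up by one; the first digit of the index is 0 exactly when σ starts with a
-- letter ≥ j. Peeling off the prefix 0110 letter by letter turns f(0110, a+5) into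
-- Σ_{z<a+4} (z+1) Σ_{y<z} Σ_{x<y} u(x), where u(x) counts the permutations of {0,…,a} with exactly one
-- descent and first letter ≥ x; the same recursion gives u(x+1) = 2^(a-x) - 1 and the Eulerian number
-- u(0) = 2^(a+1) - a - 2. The triple sum is evaluated by telescoping over ℤ, and
-- k!·C(n,k) = n(n-1)⋯(n-k+1) brings the result into the binomial form of the statement.
module Submission where

open import Defs
open import Data.Bool using (Bool; true; false; T; T?; not; if_then_else_)
open import Data.Bool.ListAction using (any)
open import Data.Bool.Properties using (if-eta; if-cong; if-cong-then)
open import Data.List using (List; []; _∷_; map; concatMap; upTo; applyUpTo; length; filterᵇ; _++_)
open import Data.List.Properties using (length-map; map-∘; map-++; map-injective; ∷-injectiveˡ; ∷-injectiveʳ)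
open import Data.List.Membership.Propositional using (_∈_; find; lose)
open import Data.List.Membership.Propositional.Properties
  using (∈-map⁺; ∈-map⁻; ∈-concatMap⁺; ∈-concatMap⁻; ∈-upTo⁺; ∈-upTo⁻; ∈-filter⁺; ∈-filter⁻)
open import Data.List.Membership.Propositional.Properties.WithK using (unique∧set⇒bag)
open import Data.List.Relation.Binary.BagAndSetEquality using (∼bag⇒↭)
open import Data.List.Relation.Binary.Disjoint.Propositional using (Disjoint)
open import Data.List.Relation.Binary.Permutation.Propositional using (_↭_)
import Data.List.Relation.Binary.Permutation.Propositional.Properties as ↭
open import Data.List.Relation.Unary.All as All using (All; []; _∷_)
open import Data.List.Relation.Unary.All.Properties using (map⁺)
open import Data.List.Relation.Unary.AllPairs using ([]; _∷_)
open import Data.List.Relation.Unary.Any using (here; there)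
open import Data.List.Relation.Unary.Any.Properties using (any⁺; any⁻)
open import Data.List.Relation.Unary.Unique.Propositional using (Unique)
import Data.List.Relation.Unary.Unique.Propositional.Properties as Unique
open import Data.Product using (_×_; _,_; proj₁)
open import Data.Unit using (tt)
open import Function using (_∘_; id; _⇔_; mk⇔; Equivalence)
open import Relation.Binary.PropositionalEquality
open import Relation.Nullary using (contradiction; ofʸ; ofⁿ)
open import Relation.Nullary.Reflects using (det; fromEquivalence)
open ≡-Reasoning

-- ℕ arithmetic is opened only inside this block, so that the statement at the end can use ℤ arithmetic unqualified.
module _ where
  open import Data.Nat
  open import Data.Nat.Properties
  open import Data.Nat.ListAction using (sum)
  open import Data.Nat.ListAction.Properties using (sum-++; sum-↭)
  open import Data.Nat.Tactic.RingSolver using (solve-∀)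
  open import Algebra.Properties.CommutativeSemigroup +-commutativeSemigroup using (interchange)

  _≥ᵇ_ : ℕ → ℕ → Bool
  h ≥ᵇ j = not (h <ᵇ j)

  punchIn : ℕ → ℕ → ℕ
  punchIn j x = if x <ᵇ j then x else suc x

  punchOut : ℕ → ℕ → ℕ
  punchOut j y = if y <ᵇ j then y else pred y

  punchIn-mono-≤ : ∀ j {x y} → x ≤ y → punchIn j x ≤ punchIn j y
  punchIn-mono-≤ j {x} {y} x≤y with x <ᵇ j | <ᵇ-reflects-< x j | y <ᵇ j | <ᵇ-reflects-< y j
  ... | true  | _       | true  | _       = x≤y
  ... | true  | _       | false | _       = m≤n⇒m≤1+n x≤y
  ... | false | ofⁿ x≮j | true  | ofʸ y<j = contradiction (≤-<-trans x≤y y<j) x≮j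
  ... | false | _       | false | _       = s≤s x≤y

  punchIn-injective : ∀ j {x y} → punchIn j x ≡ punchIn j y → x ≡ y
  punchIn-injective j {x} {y} eq with x <ᵇ j | <ᵇ-reflects-< x j | y <ᵇ j | <ᵇ-reflects-< y j
  ... | true  | _       | true  | _       = eq
  ... | true  | ofʸ x<j | false | ofⁿ y≮j = contradiction (<-trans (n<1+n y) (subst (_< j) eq x<j)) y≮j
  ... | false | ofⁿ x≮j | true  | ofʸ y<j = contradiction (<-trans (n<1+n x) (subst (_< j) (sym eq) y<j)) x≮j
  ... | false | _       | false | _       = suc-injective eq

  punchIn-mono-< : ∀ j {x y} → x < y → punchIn j x < punchIn j y
  punchIn-mono-< j x<y = ≤∧≢⇒< (punchIn-mono-≤ j (<⇒≤ x<y)) (<⇒≢ x<y ∘ punchIn-injective j)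

  punchIn-cancel-< : ∀ j {x y} → punchIn j x < punchIn j y → x < y
  punchIn-cancel-< j p = ≰⇒> (<⇒≱ p ∘ punchIn-mono-≤ j)

  punchIn-<ᵇ : ∀ j x y → (punchIn j x <ᵇ punchIn j y) ≡ (x <ᵇ y)
  punchIn-<ᵇ j x y =
    det (fromEquivalence (punchIn-cancel-< j ∘ <ᵇ⇒< _ _) (<⇒<ᵇ ∘ punchIn-mono-< j)) (<ᵇ-reflects-< x y)

  j<ᵇpunchIn : ∀ j h → (j <ᵇ punchIn j h) ≡ (h ≥ᵇ j)
  j<ᵇpunchIn j h with h <ᵇ j | <ᵇ-reflects-< h j
  ... | true  | ofʸ h<j = det (<ᵇ-reflects-< j h) (ofⁿ (<⇒≯ h<j))
  ... | false | ofⁿ h≮j = det (<ᵇ-reflects-< j (suc h)) (ofʸ (s≤s (≮⇒≥ h≮j)))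

  punchIn-≢ : ∀ j x → punchIn j x ≢ j
  punchIn-≢ j x with x <ᵇ j | <ᵇ-reflects-< x j
  ... | true  | ofʸ x<j = <⇒≢ x<j
  ... | false | ofⁿ x≮j = x≮j ∘ ≤-reflexive

  punchIn-< : ∀ {m} j {x} → x < m → punchIn j x < suc m
  punchIn-< j {x} x<m with x <ᵇ j
  ... | true  = m≤n⇒m≤1+n x<m
  ... | false = s≤s x<m

  punchIn-below : ∀ {j x} → x < j → punchIn j x ≡ x
  punchIn-below {j} {x} x<j with x <ᵇ j | <ᵇ-reflects-< x j
  ... | true  | _       = refl
  ... | false | ofⁿ x≮j = contradiction x<j x≮j

  punchIn-pred : ∀ {j y} → j < y → punchIn j (pred y) ≡ y
  punchIn-pred {j} {suc y} (s≤s j≤y) with y <ᵇ j | <ᵇ-reflects-< y j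
  ... | true  | ofʸ y<j = contradiction j≤y (<⇒≱ y<j)
  ... | false | _       = refl

  punchIn-punchOut : ∀ {j y} → j ≢ y → punchIn j (punchOut j y) ≡ y
  punchIn-punchOut {j} {y} j≢y with y <ᵇ j | <ᵇ-reflects-< y j
  ... | true  | ofʸ y<j = punchIn-below y<j
  ... | false | ofⁿ y≮j = punchIn-pred (≤∧≢⇒< (≮⇒≥ y≮j) j≢y)

  punchOut-< : ∀ {m j y} → j < suc m → y < suc m → j ≢ y → punchOut j y < m
  punchOut-< {m} {j} {y} j<1+m y<1+m j≢y with y <ᵇ j | <ᵇ-reflects-< y j
  ... | true  | ofʸ y<j = <-≤-trans y<j (≤-pred j<1+m)
  ... | false | ofⁿ y≮j = pred-< (≤∧≢⇒< (≮⇒≥ y≮j) j≢y) y<1+m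
    where
    pred-< : ∀ {y} → j < y → y < suc m → pred y < m
    pred-< {suc y} _ (s≤s y<m) = y<m

  prepend : ℕ → List ℕ → List ℕ
  prepend j σ = j ∷ map (punchIn j) σ

  index-map-punchIn : ∀ j σ → index (map (punchIn j) σ) ≡ index σ
  index-map-punchIn j []          = refl
  index-map-punchIn j (x ∷ [])    = refl
  index-map-punchIn j (x ∷ y ∷ σ) =
    cong₂ _∷_ (if-cong (punchIn-<ᵇ j x y)) (index-map-punchIn j (y ∷ σ))

  index-prepend : ∀ j h σ → index (prepend j (h ∷ σ)) ≡ (if h ≥ᵇ j then 0 else 1) ∷ index (h ∷ σ)
  index-prepend j h σ = cong₂ _∷_ (if-cong (j<ᵇpunchIn j h)) (index-map-punchIn j (h ∷ σ))

  perms : ℕ → List (List ℕ)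
  perms zero    = [] ∷ []
  perms (suc m) = concatMap (λ j → map (prepend j) (perms m)) (upTo (suc m))

  IsPerm : ℕ → List ℕ → Set
  IsPerm m π = length π ≡ m × All (_< m) π × Unique π

  concatMap-unique : ∀ {A B : Set} (f : A → List B) (label : B → A) →
    (∀ x {z} → z ∈ f x → label z ≡ x) → (∀ x → Unique (f x)) →
    ∀ {xs} → Unique xs → Unique (concatMap f xs)
  concatMap-unique f label labelled unique {[]}     _ = []
  concatMap-unique f label labelled unique {x ∷ xs} (x∉xs ∷ xs-unique) =
    Unique.++⁺ (unique x) (concatMap-unique f label labelled unique xs-unique) disjoint
    where
    disjoint : Disjoint (f x) (concatMap f xs)
    disjoint (z∈fx , z∈rest) with find (∈-concatMap⁻ f {xs = xs} z∈rest)
    ... | y , y∈xs , z∈fy = All.lookup x∉xs y∈xs (trans (sym (labelled x z∈fx)) (labelled y z∈fy))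

  first : List ℕ → ℕ
  first []      = 0
  first (x ∷ _) = x

  perms-unique : ∀ m → Unique (perms m)
  perms-unique zero    = [] ∷ []
  perms-unique (suc m) =
    concatMap-unique (λ j → map (prepend j) (perms m)) first labelled unique (Unique.upTo⁺ (suc m))
    where
    labelled : ∀ j {π} → π ∈ map (prepend j) (perms m) → first π ≡ j
    labelled j π∈ with ∈-map⁻ (prepend j) π∈
    ... | _ , _ , refl = refl
    unique : ∀ j → Unique (map (prepend j) (perms m))
    unique j = Unique.map⁺ (map-injective (punchIn-injective j) ∘ ∷-injectiveʳ) (perms-unique m)

  map-punchIn-punchOut : ∀ {j τ} → All (j ≢_) τ → map (punchIn j) (map (punchOut j) τ) ≡ τ
  map-punchIn-punchOut []           = refl
  map-punchIn-punchOut (j≢y ∷ j∉τ) = cong₂ _∷_ (punchIn-punchOut j≢y) (map-punchIn-punchOut j∉τ)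

  ∈-perms⁻ : ∀ m {π} → π ∈ perms m → IsPerm m π
  ∈-perms⁻ zero    (here refl) = refl , [] , []
  ∈-perms⁻ (suc m) π∈
    with find (∈-concatMap⁻ (λ j → map (prepend j) (perms m)) {xs = upTo (suc m)} π∈)
  ... | j , j∈ , π∈j with ∈-map⁻ (prepend j) π∈j
  ... | σ , σ∈ , refl with ∈-perms⁻ m σ∈
  ... | length≡m , bounded , unique =
      cong suc (trans (length-map (punchIn j) σ) length≡m)
    , ∈-upTo⁻ j∈ ∷ map⁺ (All.map (punchIn-< j) bounded)
    , map⁺ (All.tabulate (λ {x} _ → punchIn-≢ j x ∘ sym)) ∷ Unique.map⁺ (punchIn-injective j) unique

  ∈-perms⁺ : ∀ m {π} → IsPerm m π → π ∈ perms m
  ∈-perms⁺ zero    {[]}    _ = here refl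
  ∈-perms⁺ (suc m) {j ∷ τ} (length≡ , j<1+m ∷ bounded , j∉τ ∷ unique) =
    ∈-concatMap⁺ (λ i → map (prepend i) (perms m))
      (lose (∈-upTo⁺ j<1+m) (subst (λ π → j ∷ π ∈ map (prepend j) (perms m)) (map-punchIn-punchOut j∉τ)
        (∈-map⁺ (prepend j) (∈-perms⁺ m σ-perm))))
    where
    σ-perm : IsPerm m (map (punchOut j) τ)
    σ-perm = trans (length-map (punchOut j) τ) (suc-injective length≡)
           , map⁺ (All.zipWith (λ (y<1+m , j≢y) → punchOut-< j<1+m y<1+m j≢y) (bounded , j∉τ))
           , Unique.map⁻ (subst Unique (sym (map-punchIn-punchOut j∉τ)) unique)

  ∈-words⁺ : ∀ n k {w} → length w ≡ k → All (_< n) w → w ∈ words n k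
  ∈-words⁺ n zero    {[]}    _    _          = here refl
  ∈-words⁺ n (suc k) {a ∷ w} refl (a<n ∷ w<n) =
    ∈-concatMap⁺ (λ v → map (_∷ v) (upTo n))
      (lose (∈-words⁺ n k refl w<n) (∈-map⁺ (_∷ w) (∈-upTo⁺ a<n)))

  ∈-words⁻ : ∀ n k {w} → w ∈ words n k → length w ≡ k × All (_< n) w
  ∈-words⁻ n zero    (here refl) = refl , []
  ∈-words⁻ n (suc k) w∈
    with find (∈-concatMap⁻ (λ v → map (_∷ v) (upTo n)) {xs = words n k} w∈)
  ... | v , v∈ , w∈v with ∈-map⁻ (_∷ v) w∈v
  ... | a , a∈ , refl with ∈-words⁻ n k v∈
  ... | length≡k , v<n = cong suc length≡k , ∈-upTo⁻ a∈ ∷ v<n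

  words-unique : ∀ n k → Unique (words n k)
  words-unique n zero    = [] ∷ []
  words-unique n (suc k) =
    concatMap-unique (λ v → map (_∷ v) (upTo n)) tail labelled unique (words-unique n k)
    where
    tail : List ℕ → List ℕ
    tail []      = []
    tail (_ ∷ w) = w
    labelled : ∀ v {w} → w ∈ map (_∷ v) (upTo n) → tail w ≡ v
    labelled v w∈ with ∈-map⁻ (_∷ v) w∈
    ... | _ , _ , refl = refl
    unique : ∀ v → Unique (map (_∷ v) (upTo n))
    unique v = Unique.map⁺ ∷-injectiveˡ (Unique.upTo⁺ n)

  distinct⇒unique : ∀ xs → T (distinct xs) → Unique xs
  distinct⇒unique []       _ = []
  distinct⇒unique (x ∷ xs) d with any (λ y → x ≡ᵇ y) xs in eq
  ... | false = All.tabulate (λ y∈xs x≡y → subst T eq (any⁺ _ (lose y∈xs (≡⇒≡ᵇ x _ x≡y))))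
              ∷ distinct⇒unique xs d

  unique⇒distinct : ∀ {xs} → Unique xs → T (distinct xs)
  unique⇒distinct []                 = tt
  unique⇒distinct {x ∷ xs} (x∉xs ∷ u) with any (λ y → x ≡ᵇ y) xs in eq
  ... | false = unique⇒distinct u
  ... | true with find (any⁻ _ xs (subst T (sym eq) tt))
  ...   | y , y∈xs , x≡ᵇy = All.lookup x∉xs y∈xs (≡ᵇ⇒≡ x y x≡ᵇy)

  ∈-Sym⇔IsPerm : ∀ n {π} → π ∈ Sym n ⇔ IsPerm n π
  ∈-Sym⇔IsPerm n {π} = mk⇔ to from
    where
    to : π ∈ Sym n → IsPerm n π
    to π∈ with ∈-filter⁻ (T? ∘ distinct) {xs = words n n} π∈
    ... | π∈words , d with ∈-words⁻ n n π∈words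
    ... | length≡n , bounded = length≡n , bounded , distinct⇒unique π d
    from : IsPerm n π → π ∈ Sym n
    from (length≡n , bounded , unique) =
      ∈-filter⁺ (T? ∘ distinct) (∈-words⁺ n n length≡n bounded) (unique⇒distinct unique)

  Sym↭perms : ∀ n → Sym n ↭ perms n
  Sym↭perms n = ∼bag⇒↭ (unique∧set⇒bag
    (Unique.filter⁺ (T? ∘ distinct) (words-unique n n)) (perms-unique n)
    (mk⇔ (∈-perms⁺ n ∘ Equivalence.to (∈-Sym⇔IsPerm n))
         (Equivalence.from (∈-Sym⇔IsPerm n) ∘ ∈-perms⁻ n)))

  ∑ : ℕ → (ℕ → ℕ) → ℕ
  ∑ zero    g = 0
  ∑ (suc n) g = g 0 + ∑ n (g ∘ suc)

  ∑-cong : ∀ n {g h} → (∀ i → i < n → g i ≡ h i) → ∑ n g ≡ ∑ n h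
  ∑-cong zero    eq = refl
  ∑-cong (suc n) eq = cong₂ _+_ (eq 0 z<s) (∑-cong n (λ i i<n → eq (suc i) (s<s i<n)))

  ∑-zero : ∀ n (g : ℕ → ℕ) → (∀ i → g i ≡ 0) → ∑ n g ≡ 0
  ∑-zero zero    g eq = refl
  ∑-zero (suc n) g eq = cong₂ _+_ (eq 0) (∑-zero n (g ∘ suc) (eq ∘ suc))

  ∑-+ : ∀ n (g h : ℕ → ℕ) → ∑ n (λ i → g i + h i) ≡ ∑ n g + ∑ n h
  ∑-+ zero    g h = refl
  ∑-+ (suc n) g h = trans (cong (g 0 + h 0 +_) (∑-+ n (g ∘ suc) (h ∘ suc))) (interchange (g 0) (h 0) _ _)

  ∑-suc : ∀ n (g : ℕ → ℕ) → ∑ (suc n) g ≡ ∑ n g + g n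
  ∑-suc zero    g = +-identityʳ (g 0)
  ∑-suc (suc n) g = trans (cong (g 0 +_) (∑-suc n (g ∘ suc))) (sym (+-assoc (g 0) _ _))

  ∑-<ᵇ : ∀ n j (g : ℕ → ℕ) → j ≤ n → ∑ n (λ i → if i <ᵇ j then g i else 0) ≡ ∑ j g
  ∑-<ᵇ n       zero    g _         = ∑-zero n (λ _ → 0) (λ _ → refl)
  ∑-<ᵇ (suc n) (suc j) g (s≤s j≤n) = cong (g 0 +_) (∑-<ᵇ n j (g ∘ suc) j≤n)

  ∑-≥ᵇ : ∀ n j (g : ℕ → ℕ) →
         ∑ n (λ i → if i ≥ᵇ j then g i else 0) ≡ ∑ (n ∸ j) (λ i → g (j + i))
  ∑-≥ᵇ zero    zero    g = refl
  ∑-≥ᵇ zero    (suc j) g = refl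
  ∑-≥ᵇ (suc n) zero    g = refl
  ∑-≥ᵇ (suc n) (suc j) g = ∑-≥ᵇ n j (g ∘ suc)

  ∑-triangle : ∀ m (g : ℕ → ℕ) →
               ∑ (suc m) (λ j → ∑ m (λ i → if i ≥ᵇ j then g i else 0)) ≡ ∑ m (λ i → suc i * g i)
  ∑-triangle zero    g = refl
  ∑-triangle (suc m) g = begin
    ∑ (suc m) g + ∑ (suc m) (λ j → ∑ m (λ i → if i ≥ᵇ j then g (suc i) else 0))
      ≡⟨ cong (∑ (suc m) g +_) (∑-triangle m (g ∘ suc)) ⟩
    g 0 + ∑ m (g ∘ suc) + ∑ m (λ i → suc i * g (suc i))
      ≡⟨ +-assoc (g 0) _ _ ⟩
    g 0 + (∑ m (g ∘ suc) + ∑ m (λ i → suc i * g (suc i)))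
      ≡⟨ cong₂ _+_ (sym (+-identityʳ (g 0))) (sym (∑-+ m (g ∘ suc) _)) ⟩
    ∑ (suc m) (λ i → suc i * g i) ∎

  ∑-pow2 : ∀ m → ∑ (suc m) (λ i → 2 ^ (m ∸ i)) + 1 ≡ 2 ^ suc m
  ∑-pow2 zero    = refl
  ∑-pow2 (suc m) = begin
    2 ^ suc m + ∑ (suc m) (λ i → 2 ^ (m ∸ i)) + 1
      ≡⟨ +-assoc (2 ^ suc m) _ 1 ⟩
    2 ^ suc m + (∑ (suc m) (λ i → 2 ^ (m ∸ i)) + 1)
      ≡⟨ cong (2 ^ suc m +_) (trans (∑-pow2 m) (sym (+-identityʳ _))) ⟩
    2 ^ suc (suc m) ∎

  ∑-pow2-from : ∀ m x → ∑ (suc m ∸ x) (λ i → 2 ^ (m ∸ (x + i))) + 1 ≡ 2 ^ (suc m ∸ x)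
  ∑-pow2-from m       zero    = ∑-pow2 m
  ∑-pow2-from zero    (suc x) rewrite 0∸n≡0 x = refl
  ∑-pow2-from (suc m) (suc x) = ∑-pow2-from m x

  𝟙 : Bool → ℕ
  𝟙 b = if b then 1 else 0

  χ : BinStr → BinStr → ℕ
  χ r s = 𝟙 (matches r s)

  noDescents : BinStr → ℕ
  noDescents s = 𝟙 (ones s ≡ᵇ 0)

  countPerms : ℕ → (ℕ → Bool) → (BinStr → ℕ) → ℕ
  countPerms m P w = sum (map (λ π → if P (first π) then w (index π) else 0) (perms m))

  length-filterᵇ : ∀ {A : Set} (p : A → Bool) xs → length (filterᵇ p xs) ≡ sum (map (𝟙 ∘ p) xs)
  length-filterᵇ p []       = refl
  length-filterᵇ p (x ∷ xs) with p x
  ... | true  = cong suc (length-filterᵇ p xs)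
  ... | false = length-filterᵇ p xs

  sum-map-concatMap : ∀ {A B : Set} (F : B → ℕ) (h : A → List B) xs →
    sum (map F (concatMap h xs)) ≡ sum (map (λ x → sum (map F (h x))) xs)
  sum-map-concatMap F h []       = refl
  sum-map-concatMap F h (x ∷ xs) = begin
    sum (map F (h x ++ concatMap h xs))              ≡⟨ cong sum (map-++ F (h x) _) ⟩
    sum (map F (h x) ++ map F (concatMap h xs))      ≡⟨ sum-++ (map F (h x)) _ ⟩
    sum (map F (h x)) + sum (map F (concatMap h xs)) ≡⟨ cong (sum (map F (h x)) +_) (sum-map-concatMap F h xs) ⟩
    sum (map (λ x → sum (map F (h x))) (x ∷ xs))     ∎

  sum-map-applyUpTo : ∀ (g f : ℕ → ℕ) n → sum (map g (applyUpTo f n)) ≡ ∑ n (g ∘ f)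
  sum-map-applyUpTo g f zero    = refl
  sum-map-applyUpTo g f (suc n) = cong (g (f 0) +_) (sum-map-applyUpTo g (f ∘ suc) n)

  sum-map-+ : ∀ {A : Set} (F G : A → ℕ) xs →
              sum (map (λ x → F x + G x) xs) ≡ sum (map F xs) + sum (map G xs)
  sum-map-+ F G []       = refl
  sum-map-+ F G (x ∷ xs) = trans (cong (F x + G x +_) (sum-map-+ F G xs)) (interchange (F x) (G x) _ _)

  sum-map-cong-∈ : ∀ {A : Set} {F G : A → ℕ} xs →
                   (∀ {x} → x ∈ xs → F x ≡ G x) → sum (map F xs) ≡ sum (map G xs)
  sum-map-cong-∈ []       eq = refl
  sum-map-cong-∈ (x ∷ xs) eq = cong₂ _+_ (eq (here refl)) (sum-map-cong-∈ xs (eq ∘ there))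

  sum-map-zero : ∀ {A : Set} {F : A → ℕ} → (∀ x → F x ≡ 0) → ∀ xs → sum (map F xs) ≡ 0
  sum-map-zero eq []       = refl
  sum-map-zero eq (x ∷ xs) = cong₂ _+_ (eq x) (sum-map-zero eq xs)

  sum-map-if : ∀ {A : Set} b (F : A → ℕ) xs →
               sum (map (λ x → if b then F x else 0) xs) ≡ (if b then sum (map F xs) else 0)
  sum-map-if true  F xs = refl
  sum-map-if false F xs = sum-map-zero (λ _ → refl) xs

  f≡countPerms : ∀ r n → f r n ≡ countPerms n (λ _ → true) (χ r)
  f≡countPerms r n = trans (length-filterᵇ (matches r ∘ index) (Sym n))
                           (sum-↭ (↭.map⁺ (χ r ∘ index) (Sym↭perms n)))

  countPerms-zero : ∀ m P w → (∀ s → w s ≡ 0) → countPerms m P w ≡ 0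
  countPerms-zero m P w w≡0 = sum-map-zero weight≡0 (perms m)
    where
    weight≡0 : ∀ π → (if P (first π) then w (index π) else 0) ≡ 0
    weight≡0 π = trans (if-cong-then (P (first π)) (w≡0 (index π))) (if-eta (P (first π)))

  first-digit-split : ∀ (w : BinStr → ℕ) b s → w ((if not b then 0 else 1) ∷ s)
                              ≡ (if not b then w (0 ∷ s) else 0) + (if b then w (1 ∷ s) else 0)
  first-digit-split w true  s = refl
  first-digit-split w false s = sym (+-identityʳ _)

  countPerms-prepend : ∀ m j w →
    sum (map (λ σ → w (index (prepend j σ))) (perms (suc m)))
      ≡ countPerms (suc m) (_≥ᵇ j) (w ∘ (0 ∷_)) + countPerms (suc m) (_<ᵇ j) (w ∘ (1 ∷_))
  countPerms-prepend m j w =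
    trans (sum-map-cong-∈ (perms (suc m)) (λ {σ} σ∈ → split σ (proj₁ (∈-perms⁻ (suc m) σ∈))))
          (sum-map-+ (λ σ → if first σ ≥ᵇ j then w (0 ∷ index σ) else 0)
                     (λ σ → if first σ <ᵇ j then w (1 ∷ index σ) else 0) (perms (suc m)))
    where
    split : ∀ σ → length σ ≡ suc m → w (index (prepend j σ))
          ≡ (if first σ ≥ᵇ j then w (0 ∷ index σ) else 0) + (if first σ <ᵇ j then w (1 ∷ index σ) else 0)
    split (h ∷ τ) _ = trans (cong w (index-prepend j h τ)) (first-digit-split w (h <ᵇ j) (index (h ∷ τ)))

  countPerms-suc-suc : ∀ m P w → countPerms (suc (suc m)) P w ≡
    ∑ (suc (suc m)) (λ j → if P j then countPerms (suc m) (_≥ᵇ j) (w ∘ (0 ∷_))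
                                     + countPerms (suc m) (_<ᵇ j) (w ∘ (1 ∷_)) else 0)
  countPerms-suc-suc m P w = begin
    countPerms (suc (suc m)) P w
      ≡⟨ sum-map-concatMap F (λ j → map (prepend j) (perms (suc m))) (upTo (suc (suc m))) ⟩
    sum (map (λ j → sum (map F (map (prepend j) (perms (suc m))))) (upTo (suc (suc m))))
      ≡⟨ sum-map-applyUpTo (λ j → sum (map F (map (prepend j) (perms (suc m))))) id (suc (suc m)) ⟩
    ∑ (suc (suc m)) (λ j → sum (map F (map (prepend j) (perms (suc m)))))
      ≡⟨ ∑-cong (suc (suc m)) (λ j _ → first-letter j) ⟩
    ∑ (suc (suc m)) (λ j → if P j then countPerms (suc m) (_≥ᵇ j) (w ∘ (0 ∷_))
                                     + countPerms (suc m) (_<ᵇ j) (w ∘ (1 ∷_)) else 0) ∎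
    where
    F : List ℕ → ℕ
    F π = if P (first π) then w (index π) else 0
    first-letter : ∀ j → sum (map F (map (prepend j) (perms (suc m))))
      ≡ (if P j then countPerms (suc m) (_≥ᵇ j) (w ∘ (0 ∷_))
                   + countPerms (suc m) (_<ᵇ j) (w ∘ (1 ∷_)) else 0)
    first-letter j = begin
      sum (map F (map (prepend j) (perms (suc m))))
        ≡⟨ cong sum (map-∘ (perms (suc m))) ⟨
      sum (map (λ σ → if P j then w (index (prepend j σ)) else 0) (perms (suc m)))
        ≡⟨ sum-map-if (P j) _ (perms (suc m)) ⟩
      (if P j then sum (map (λ σ → w (index (prepend j σ))) (perms (suc m))) else 0)
        ≡⟨ if-cong-then (P j) (countPerms-prepend m j w) ⟩
      (if P j then countPerms (suc m) (_≥ᵇ j) (w ∘ (0 ∷_))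
                 + countPerms (suc m) (_<ᵇ j) (w ∘ (1 ∷_)) else 0) ∎

  countPerms-ascent-first : ∀ m P w → (∀ s → w (1 ∷ s) ≡ 0) →
    countPerms (suc (suc m)) P w
      ≡ ∑ (suc (suc m)) (λ j → if P j then countPerms (suc m) (_≥ᵇ j) (w ∘ (0 ∷_)) else 0)
  countPerms-ascent-first m P w w₁≡0 = begin
    countPerms (suc (suc m)) P w
      ≡⟨ countPerms-suc-suc m P w ⟩
    ∑ (suc (suc m)) (λ j → if P j then ascents j + descents j else 0)
      ≡⟨ ∑-cong (suc (suc m)) (λ j _ → no-descents j) ⟩
    ∑ (suc (suc m)) (λ j → if P j then ascents j else 0) ∎
    where
    ascents descents : ℕ → ℕ
    ascents  j = countPerms (suc m) (_≥ᵇ j) (w ∘ (0 ∷_))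
    descents j = countPerms (suc m) (_<ᵇ j) (w ∘ (1 ∷_))
    no-descents : ∀ j → (if P j then ascents j + descents j else 0) ≡ (if P j then ascents j else 0)
    no-descents j = if-cong-then (P j)
      (trans (cong (ascents j +_) (countPerms-zero (suc m) (_<ᵇ j) (w ∘ (1 ∷_)) w₁≡0))
             (+-identityʳ (ascents j)))

  countPerms-descent-first : ∀ m P w → (∀ s → w (0 ∷ s) ≡ 0) →
    countPerms (suc (suc m)) P w
      ≡ ∑ (suc (suc m)) (λ j → if P j then countPerms (suc m) (_<ᵇ j) (w ∘ (1 ∷_)) else 0)
  countPerms-descent-first m P w w₀≡0 = begin
    countPerms (suc (suc m)) P w
      ≡⟨ countPerms-suc-suc m P w ⟩
    ∑ (suc (suc m)) (λ j → if P j then ascents j + descents j else 0)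
      ≡⟨ ∑-cong (suc (suc m)) (λ j _ → no-ascents j) ⟩
    ∑ (suc (suc m)) (λ j → if P j then descents j else 0) ∎
    where
    ascents descents : ℕ → ℕ
    ascents  j = countPerms (suc m) (_≥ᵇ j) (w ∘ (0 ∷_))
    descents j = countPerms (suc m) (_<ᵇ j) (w ∘ (1 ∷_))
    no-ascents : ∀ j → (if P j then ascents j + descents j else 0) ≡ (if P j then descents j else 0)
    no-ascents j = if-cong-then (P j)
      (cong (_+ descents j) (countPerms-zero (suc m) (_≥ᵇ j) (w ∘ (0 ∷_)) w₀≡0))

  countPerms-noDescents : ∀ m P → countPerms (suc m) P noDescents ≡ 𝟙 (P 0)
  countPerms-noDescents zero    P = +-identityʳ (𝟙 (P 0))
  countPerms-noDescents (suc m) P = begin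
    countPerms (suc (suc m)) P noDescents
      ≡⟨ countPerms-ascent-first m P noDescents (λ _ → refl) ⟩
    ∑ (suc (suc m)) (λ j → if P j then countPerms (suc m) (_≥ᵇ j) noDescents else 0)
      ≡⟨ ∑-cong (suc (suc m)) (λ j _ → if-cong-then (P j) {y = 0} (countPerms-noDescents m (_≥ᵇ j))) ⟩
    𝟙 (P 0) + ∑ (suc m) (λ j → if P (suc j) then 0 else 0)
      ≡⟨ cong (𝟙 (P 0) +_) (∑-zero (suc m) _ (λ j → if-eta (P (suc j)))) ⟩
    𝟙 (P 0) + 0
      ≡⟨ +-identityʳ (𝟙 (P 0)) ⟩
    𝟙 (P 0) ∎

  oneDescentFrom : ℕ → ℕ → ℕ
  oneDescentFrom m x = countPerms (suc m) (_≥ᵇ x) (χ [])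

  oneDescentFrom-suc : ∀ m x → oneDescentFrom m (suc x) + 1 ≡ 2 ^ (m ∸ x)
  oneDescent-head-suc : ∀ m i → oneDescentFrom m (suc i) + countPerms (suc m) (_<ᵇ suc i) noDescents ≡ 2 ^ (m ∸ i)

  oneDescentFrom-suc zero    x rewrite 0∸n≡0 x = refl
  oneDescentFrom-suc (suc m) x = begin
    oneDescentFrom (suc m) (suc x) + 1
      ≡⟨ cong (_+ 1) (countPerms-suc-suc m (_≥ᵇ suc x) (χ [])) ⟩
    ∑ (suc m) (λ i → if i ≥ᵇ x then head-suc i else 0) + 1
      ≡⟨ cong (_+ 1) (∑-cong (suc m) (λ i _ → if-cong-then (i ≥ᵇ x) {y = 0} (oneDescent-head-suc m i))) ⟩
    ∑ (suc m) (λ i → if i ≥ᵇ x then 2 ^ (m ∸ i) else 0) + 1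
      ≡⟨ cong (_+ 1) (∑-≥ᵇ (suc m) x (λ i → 2 ^ (m ∸ i))) ⟩
    ∑ (suc m ∸ x) (λ i → 2 ^ (m ∸ (x + i))) + 1
      ≡⟨ ∑-pow2-from m x ⟩
    2 ^ (suc m ∸ x) ∎
    where
    head-suc : ℕ → ℕ
    head-suc i = oneDescentFrom m (suc i) + countPerms (suc m) (_<ᵇ suc i) noDescents

  oneDescent-head-suc m i =
    trans (cong (oneDescentFrom m (suc i) +_) (countPerms-noDescents m (_<ᵇ suc i)))
          (oneDescentFrom-suc m i)

  oneDescentFrom-zero : ∀ m → oneDescentFrom m 0 + m + 2 ≡ 2 ^ suc m
  oneDescentFrom-zero zero    = refl
  oneDescentFrom-zero (suc m) = begin
    oneDescentFrom (suc m) 0 + suc m + 2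
      ≡⟨ cong (λ c → c + suc m + 2) (countPerms-suc-suc m (λ _ → true) (χ [])) ⟩
    X + countPerms (suc m) (_<ᵇ 0) noDescents + ∑ (suc m) head-suc + suc m + 2
      ≡⟨ cong₂ (λ c d → X + c + d + suc m + 2) (countPerms-noDescents m (_<ᵇ 0))
                                                (∑-cong (suc m) (λ i _ → oneDescent-head-suc m i)) ⟩
    X + 0 + G + suc m + 2
      ≡⟨ rearrange X G m ⟩
    (X + m + 2) + (G + 1)
      ≡⟨ cong₂ _+_ (oneDescentFrom-zero m) (∑-pow2 m) ⟩
    2 ^ suc m + 2 ^ suc m
      ≡⟨ cong (2 ^ suc m +_) (sym (+-identityʳ _)) ⟩
    2 ^ suc (suc m) ∎
    where
    X G : ℕ
    X = oneDescentFrom m 0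
    G = ∑ (suc m) (λ i → 2 ^ (m ∸ i))
    head-suc : ℕ → ℕ
    head-suc i = oneDescentFrom m (suc i) + countPerms (suc m) (_<ᵇ suc i) noDescents
    rearrange : ∀ X G m → X + 0 + G + suc m + 2 ≡ (X + m + 2) + (G + 1)
    rearrange = solve-∀

  f0110≡∑∑∑ : ∀ a → f (0 ∷ 1 ∷ 1 ∷ 0 ∷ []) (5 + a)
                  ≡ ∑ (4 + a) (λ z → suc z * ∑ z (λ y → ∑ y (oneDescentFrom a)))
  f0110≡∑∑∑ a = begin
    f (0 ∷ 1 ∷ 1 ∷ 0 ∷ []) (5 + a)
      ≡⟨ f≡countPerms (0 ∷ 1 ∷ 1 ∷ 0 ∷ []) (5 + a) ⟩
    countPerms (5 + a) (λ _ → true) (χ (0 ∷ 1 ∷ 1 ∷ 0 ∷ []))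
      ≡⟨ countPerms-ascent-first (3 + a) (λ _ → true) (χ (0 ∷ 1 ∷ 1 ∷ 0 ∷ [])) (λ _ → refl) ⟩
    ∑ (5 + a) (λ j → countPerms (4 + a) (_≥ᵇ j) (χ (1 ∷ 1 ∷ 0 ∷ [])))
      ≡⟨ ∑-cong (5 + a) (λ j _ → χ110-as-∑ j) ⟩
    ∑ (5 + a) (λ j → ∑ (4 + a) (λ z → if z ≥ᵇ j then L z else 0))
      ≡⟨ ∑-triangle (4 + a) L ⟩
    ∑ (4 + a) (λ z → suc z * L z)
      ≡⟨ ∑-cong (4 + a) (λ z z<4+a → cong (suc z *_) (χ10-as-∑ z (≤-pred z<4+a))) ⟩
    ∑ (4 + a) (λ z → suc z * ∑ z (λ y → ∑ y u)) ∎
    where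
    u L : ℕ → ℕ
    u = oneDescentFrom a
    L z = countPerms (3 + a) (_<ᵇ z) (χ (1 ∷ 0 ∷ []))
    χ110-as-∑ : ∀ j → countPerms (4 + a) (_≥ᵇ j) (χ (1 ∷ 1 ∷ 0 ∷ []))
                    ≡ ∑ (4 + a) (λ z → if z ≥ᵇ j then L z else 0)
    χ110-as-∑ j = countPerms-descent-first (2 + a) (_≥ᵇ j) (χ (1 ∷ 1 ∷ 0 ∷ [])) (λ _ → refl)
    χ0-as-∑ : ∀ y → y ≤ 2 + a → countPerms (2 + a) (_<ᵇ y) (χ (0 ∷ [])) ≡ ∑ y u
    χ0-as-∑ y y≤2+a =
      trans (countPerms-ascent-first a (_<ᵇ y) (χ (0 ∷ [])) (λ _ → refl)) (∑-<ᵇ (2 + a) y u y≤2+a)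
    χ10-as-∑ : ∀ z → z ≤ 3 + a → L z ≡ ∑ z (λ y → ∑ y u)
    χ10-as-∑ z z≤3+a = begin
      L z
        ≡⟨ countPerms-descent-first (1 + a) (_<ᵇ z) (χ (1 ∷ 0 ∷ [])) (λ _ → refl) ⟩
      ∑ (3 + a) (λ y → if y <ᵇ z then countPerms (2 + a) (_<ᵇ y) (χ (0 ∷ [])) else 0)
        ≡⟨ ∑-<ᵇ (3 + a) z _ z≤3+a ⟩
      ∑ z (λ y → countPerms (2 + a) (_<ᵇ y) (χ (0 ∷ [])))
        ≡⟨ ∑-cong z (λ y y<z → χ0-as-∑ y (≤-pred (≤-trans y<z z≤3+a))) ⟩
      ∑ z (λ y → ∑ y u) ∎

open import Data.Nat as ℕ using (ℕ; zero; suc; _^_; _∸_; _≥_; _!; s≤s)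
import Data.Nat.Properties as ℕₚ
open import Data.Nat.Combinatorics using (_C_; nCk+nC[k+1]≡[n+1]C[k+1])
open import Data.Integer using (ℤ; +_; _+_; _-_; _*_)
open import Data.Integer.Properties
  using (pos-*; *-zeroˡ; *-zeroʳ; *-identityˡ; *-distribˡ-+; *-assoc; *-cancelˡ-≡)
open import Data.Integer.Tactic.RingSolver using (solve-∀)

x+y≡z⇒x≡z-y : ∀ {x} y {z} → x + y ≡ z → x ≡ z - y
x+y≡z⇒x≡z-y {x} y refl = lemma x y
  where
  lemma : ∀ x y → x ≡ x + y - y
  lemma = solve-∀

-- The exponent e runs alongside z with z + e = K, which avoids the truncated subtraction in 2 ^ (K ∸ z).
telescope : ∀ (c : ℤ) (g : ℕ → ℕ) (Φ G : ℤ → ℤ → ℤ) K →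
  Φ (+ 0) (+ (2 ^ K)) ≡ + 0 →
  (∀ Z E → Φ (+ 1 + Z) E ≡ Φ Z (+ 2 * E) + G Z E) →
  (∀ z e → suc z ℕ.+ e ≡ K → c * + g z ≡ G (+ z) (+ (2 ^ e))) →
  ∀ z e → z ℕ.+ e ≡ K → c * + ∑ z g ≡ Φ (+ z) (+ (2 ^ e))
telescope c g Φ G K base step summand zero    e refl = trans (*-zeroʳ c) (sym base)
telescope c g Φ G K base step summand (suc z) e z+e≡K = begin
  c * + ∑ (suc z) g
    ≡⟨ cong (λ s → c * + s) (∑-suc z g) ⟩
  c * (+ ∑ z g + + g z)
    ≡⟨ *-distribˡ-+ c (+ ∑ z g) (+ g z) ⟩
  c * + ∑ z g + c * + g z
    ≡⟨ cong₂ _+_ (telescope c g Φ G K base step summand z (suc e) (trans (ℕₚ.+-suc z e) z+e≡K))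
                 (summand z e z+e≡K) ⟩
  Φ (+ z) (+ (2 ^ suc e)) + G (+ z) (+ (2 ^ e))
    ≡⟨ cong (λ E → Φ (+ z) E + G (+ z) (+ (2 ^ e))) (pos-* 2 (2 ^ e)) ⟩
  Φ (+ z) (+ 2 * + (2 ^ e)) + G (+ z) (+ (2 ^ e))
    ≡⟨ step (+ z) (+ (2 ^ e)) ⟨
  Φ (+ suc z) (+ (2 ^ e)) ∎

-- Closed forms of the three nested partial sums below, as polynomials in the summation bound and E = 2 ^ e,
-- with P = 2 ^ (a + 1) and T = u 0 + P. INLINE lets the ring solver see through them.
Φ₁ : ℤ → ℤ → ℤ → ℤ
Φ₁ P y E = P - E - y
{-# INLINE Φ₁ #-}

Φ₂ : ℤ → ℤ → ℤ → ℤ → ℤ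
Φ₂ T P z E = + 2 * z * T - z * (z - + 1) - + 4 * P + + 2 * E
{-# INLINE Φ₂ #-}

Φ₃ : ℤ → ℤ → ℤ → ℤ → ℤ
Φ₃ T P N E = (+ 4 * T - + 2) * N * (N - + 1) * (+ 2 * N - + 1) + (+ 24 * T + + 12 - + 24 * P) * N * (N - + 1)
           - + 3 * N * N * (N - + 1) * (N - + 1) - + 96 * P * N + + 288 * P - + 24 * (N + + 3) * E
{-# INLINE Φ₃ #-}

Φ₁-base : ∀ P → Φ₁ P (+ 0) P ≡ + 0
Φ₁-base = solve-∀

Φ₁-step : ∀ P Z E → Φ₁ P (+ 1 + Z) E ≡ Φ₁ P Z (+ 2 * E) + (E - + 1)
Φ₁-step = solve-∀

Φ₂-base : ∀ T P → Φ₂ T P (+ 0) (+ 2 * P) ≡ + 0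
Φ₂-base = solve-∀

Φ₂-step : ∀ U P Z E → Φ₂ (U + P) P (+ 1 + Z) E ≡ Φ₂ (U + P) P Z (+ 2 * E) + + 2 * (U + Φ₁ P Z E)
Φ₂-step = solve-∀

Φ₃-base : ∀ T P → Φ₃ T P (+ 0) (+ 2 * (+ 2 * P)) ≡ + 0
Φ₃-base = solve-∀

Φ₃-step : ∀ T P Z E → Φ₃ T P (+ 1 + Z) E ≡ Φ₃ T P Z (+ 2 * E) + + 12 * (+ 2 + Z) * Φ₂ T P Z E
Φ₃-step = solve-∀

module _ (a : ℕ) (u : ℕ → ℕ) (u-suc : ∀ x → u (suc x) ℕ.+ 1 ≡ 2 ^ (a ∸ x)) where

  private
    P t : ℤ
    P = + (2 ^ suc a)
    t = + u 0 + P

    h : ℕ → ℕ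
    h y = ∑ (suc y) u

  ∑u∘suc≡Φ₁ : ∀ y e → y ℕ.+ e ≡ suc a → + ∑ y (u ∘ suc) ≡ Φ₁ P (+ y) (+ (2 ^ e))
  ∑u∘suc≡Φ₁ y e y+e≡1+a = trans (sym (*-identityˡ (+ ∑ y (u ∘ suc))))
    (telescope (+ 1) (u ∘ suc) (Φ₁ P) (λ _ E → E - + 1) (suc a) (Φ₁-base P) (Φ₁-step P) summand y e y+e≡1+a)
    where
    summand : ∀ z e → suc z ℕ.+ e ≡ suc a → + 1 * + u (suc z) ≡ + (2 ^ e) - + 1
    summand z e eq =
      trans (*-identityˡ (+ u (suc z))) (x+y≡z⇒x≡z-y (+ 1) (cong +_ (trans (u-suc z) (cong (2 ^_) a∸z≡e))))
      where
      a∸z≡e : a ∸ z ≡ e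
      a∸z≡e = trans (cong (_∸ z) (sym (ℕₚ.suc-injective eq))) (ℕₚ.m+n∸m≡n z e)

  2∑h≡Φ₂ : ∀ z e → z ℕ.+ e ≡ suc (suc a) → + 2 * + ∑ z h ≡ Φ₂ t P (+ z) (+ (2 ^ e))
  2∑h≡Φ₂ = telescope (+ 2) h (Φ₂ t P) (λ Z E → + 2 * (+ u 0 + Φ₁ P Z E)) (suc (suc a))
                     base (Φ₂-step (+ u 0) P) summand
    where
    base : Φ₂ t P (+ 0) (+ (2 ^ suc (suc a))) ≡ + 0
    base = trans (cong (Φ₂ t P (+ 0)) (pos-* 2 (2 ^ suc a))) (Φ₂-base t P)
    summand : ∀ z e → suc z ℕ.+ e ≡ suc (suc a) → + 2 * + h z ≡ + 2 * (+ u 0 + Φ₁ P (+ z) (+ (2 ^ e)))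
    summand z e eq = cong (λ s → + 2 * (+ u 0 + s)) (∑u∘suc≡Φ₁ z e (ℕₚ.suc-injective eq))

  24∑k≡Φ₃ : ∀ N e → N ℕ.+ e ≡ 3 ℕ.+ a →
            + 24 * + ∑ N (λ z → suc (suc z) ℕ.* ∑ z h) ≡ Φ₃ t P (+ N) (+ (2 ^ e))
  24∑k≡Φ₃ = telescope (+ 24) (λ z → suc (suc z) ℕ.* ∑ z h) (Φ₃ t P) (λ Z E → + 12 * (+ 2 + Z) * Φ₂ t P Z E)
                      (3 ℕ.+ a) base (Φ₃-step t P) summand
    where
    base : Φ₃ t P (+ 0) (+ (2 ^ (3 ℕ.+ a))) ≡ + 0
    base = trans (cong (Φ₃ t P (+ 0)) (trans (pos-* 2 (2 ^ suc (suc a))) (cong (+ 2 *_) (pos-* 2 (2 ^ suc a)))))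
                 (Φ₃-base t P)
    regroup : ∀ Z S → + 24 * ((+ 2 + Z) * S) ≡ + 12 * (+ 2 + Z) * (+ 2 * S)
    regroup = solve-∀
    summand : ∀ z e → suc z ℕ.+ e ≡ 3 ℕ.+ a →
      + 24 * + (suc (suc z) ℕ.* ∑ z h) ≡ + 12 * (+ 2 + + z) * Φ₂ t P (+ z) (+ (2 ^ e))
    summand z e eq = begin
      + 24 * + (suc (suc z) ℕ.* ∑ z h)
        ≡⟨ cong (+ 24 *_) (pos-* (suc (suc z)) (∑ z h)) ⟩
      + 24 * ((+ 2 + + z) * + ∑ z h)
        ≡⟨ regroup (+ z) (+ ∑ z h) ⟩
      + 12 * (+ 2 + + z) * (+ 2 * + ∑ z h)
        ≡⟨ cong (+ 12 * (+ 2 + + z) *_) (2∑h≡Φ₂ z e (ℕₚ.suc-injective eq)) ⟩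
      + 12 * (+ 2 + + z) * Φ₂ t P (+ z) (+ (2 ^ e)) ∎

  -- The z = 0 and y = 0 terms vanish, so the left-hand side is definitionally 24 ∑_{z<a+3} (z+2) ∑_{y<z} h y.
  24∑∑∑≡Φ₃ : + 24 * + ∑ (4 ℕ.+ a) (λ z → suc z ℕ.* ∑ z (λ y → ∑ y u))
                    ≡ Φ₃ (+ u 0 + + (2 ^ suc a)) (+ (2 ^ suc a)) (+ (3 ℕ.+ a)) (+ 1)
  24∑∑∑≡Φ₃ = 24∑k≡Φ₃ (3 ℕ.+ a) 0 (ℕₚ.+-identityʳ (3 ℕ.+ a))

falling : ℤ → ℕ → ℤ
falling x zero    = + 1
falling x (suc k) = falling x k * (x - + k)

falling-suc : ∀ x k → falling (+ 1 + x) (suc k) ≡ (+ 1 + x) * falling x k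
falling-suc x zero    = base x
  where
  base : ∀ x → + 1 * ((+ 1 + x) - + 0) ≡ (+ 1 + x) * + 1
  base = solve-∀
falling-suc x (suc k) = begin
  falling (+ 1 + x) (suc k) * ((+ 1 + x) - + suc k) ≡⟨ cong (_* ((+ 1 + x) - + suc k)) (falling-suc x k) ⟩
  (+ 1 + x) * falling x k * ((+ 1 + x) - + suc k)   ≡⟨ shift x (falling x k) (+ k) ⟩
  (+ 1 + x) * (falling x k * (x - + k))             ∎
  where
  shift : ∀ x F k → (+ 1 + x) * F * ((+ 1 + x) - (+ 1 + k)) ≡ (+ 1 + x) * (F * (x - k))
  shift = solve-∀

falling-zero : ∀ k → falling (+ 0) (suc k) ≡ + 0
falling-zero zero    = refl
falling-zero (suc k) = trans (cong (_* (+ 0 - + suc k)) (falling-zero k)) (*-zeroˡ (+ 0 - + suc k))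

factorial-choose : ∀ k m → + (k !) * + (m C k) ≡ falling (+ m) k
factorial-choose zero    m       = refl
factorial-choose (suc k) zero    = trans (*-zeroʳ (+ ((suc k) !))) (sym (falling-zero k))
factorial-choose (suc k) (suc m) = begin
  + ((suc k) !) * + (suc m C suc k)
    ≡⟨ cong (λ c → + ((suc k) !) * + c) (nCk+nC[k+1]≡[n+1]C[k+1] m k) ⟨
  + ((suc k) !) * (+ (m C k) + + (m C suc k))
    ≡⟨ *-distribˡ-+ (+ ((suc k) !)) (+ (m C k)) (+ (m C suc k)) ⟩
  + ((suc k) !) * + (m C k) + + ((suc k) !) * + (m C suc k)
    ≡⟨ cong₂ _+_ (trans (cong (_* + (m C k)) (pos-* (suc k) (k !))) (*-assoc (+ suc k) (+ (k !)) (+ (m C k))))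
                 (factorial-choose (suc k) m) ⟩
  + suc k * (+ (k !) * + (m C k)) + falling (+ m) (suc k)
    ≡⟨ cong (λ c → + suc k * c + falling (+ m) (suc k)) (factorial-choose k m) ⟩
  + suc k * falling (+ m) k + falling (+ m) k * (+ m - + k)
    ≡⟨ pascal (falling (+ m) k) (+ m) (+ k) ⟩
  (+ 1 + + m) * falling (+ m) k
    ≡⟨ falling-suc (+ m) k ⟨
  falling (+ suc m) (suc k) ∎
  where
  pascal : ∀ F M K → (+ 1 + K) * F + F * (M - K) ≡ (+ 1 + M) * F
  pascal = solve-∀

scaled-rhs : ℤ → ℤ → ℤ → ℤ → ℤ → ℤ
scaled-rhs X₂ X₃ X₄ Q N =
  (+ 4 * X₃ - + 12 * X₂ + + 96) * Q - + 11 * X₄ + + 20 * X₃ - + 24 * X₂ - + 48 * N + + 72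
{-# INLINE scaled-rhs #-}

scaled-rhs-expand : ∀ C₂ C₃ C₄ Q N →
  + 24 * (((C₃ - C₂ + + 4) * Q) - + 11 * C₄ + + 5 * C₃ - + 2 * C₂ - + 2 * N + + 3)
  ≡ scaled-rhs (+ 2 * C₂) (+ 6 * C₃) (+ 24 * C₄) Q N
scaled-rhs-expand = solve-∀

-- The first three arguments are falling N 2, falling N 3 and falling N 4 unfolded: the solver does not unfold definitions.
scaled-rhs-falling : ∀ P N →
  scaled-rhs (+ 1 * (N - + 0) * (N - + 1)) (+ 1 * (N - + 0) * (N - + 1) * (N - + 2))
             (+ 1 * (N - + 0) * (N - + 1) * (N - + 2) * (N - + 3)) (+ 2 * (+ 2 * P)) N
  ≡ Φ₃ (P - + 2 - (N - + 5) + P) P (N - + 2) (+ 1)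
scaled-rhs-falling = solve-∀

24×rhs≡Φ₃ : ∀ a → let n = 5 ℕ.+ a ; P = + (2 ^ suc a) in
  + 24 * (((+ (n C 3) - + (n C 2) + + 4) * + (2 ^ (n ∸ 2)))
          - + 11 * + (n C 4) + + 5 * + (n C 3) - + 2 * + (n C 2) - + 2 * + n + + 3)
  ≡ Φ₃ (P - + 2 - + a + P) P (+ (3 ℕ.+ a)) (+ 1)
24×rhs≡Φ₃ a = begin
  _ ≡⟨ scaled-rhs-expand (+ (n C 2)) (+ (n C 3)) (+ (n C 4)) (+ (2 ^ (n ∸ 2))) (+ n) ⟩
  scaled-rhs (+ 2 * + (n C 2)) (+ 6 * + (n C 3)) (+ 24 * + (n C 4)) (+ (2 ^ (n ∸ 2))) (+ n)
    ≡⟨ scaled-rhs-cong (factorial-choose 2 n) (factorial-choose 3 n) (factorial-choose 4 n) power ⟩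
  scaled-rhs (falling (+ n) 2) (falling (+ n) 3) (falling (+ n) 4) (+ 2 * (+ 2 * P)) (+ n)
    ≡⟨ scaled-rhs-falling P (+ n) ⟩
  Φ₃ (P - + 2 - + a + P) P (+ (3 ℕ.+ a)) (+ 1) ∎
  where
  n : ℕ
  n = 5 ℕ.+ a
  P : ℤ
  P = + (2 ^ suc a)
  power : + (2 ^ (n ∸ 2)) ≡ + 2 * (+ 2 * P)
  power = trans (pos-* 2 (2 ^ suc (suc a))) (cong (+ 2 *_) (pos-* 2 (2 ^ suc a)))
  scaled-rhs-cong : ∀ {X₂ Y₂ X₃ Y₃ X₄ Y₄ Q R} → X₂ ≡ Y₂ → X₃ ≡ Y₃ → X₄ ≡ Y₄ → Q ≡ R →
                    scaled-rhs X₂ X₃ X₄ Q (+ n) ≡ scaled-rhs Y₂ Y₃ Y₄ R (+ n)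
  scaled-rhs-cong refl refl refl refl = refl

lemma4p6 : (n : ℕ) → n ≥ 3 →
    + f (0 ∷ 1 ∷ 1 ∷ 0 ∷ []) n
    ≡ ((+ (n C 3) - + (n C 2) + + 4) * + (2 ^ (n ∸ 2)))
    - + 11 * + (n C 4) + + 5 * + (n C 3) - + 2 * + (n C 2) - + 2 * + n + + 3
lemma4p6 0 ()
lemma4p6 1 (s≤s ())
lemma4p6 2 (s≤s (s≤s ()))
lemma4p6 3 _ = refl
lemma4p6 4 _ = refl
lemma4p6 (suc (suc (suc (suc (suc a))))) _ = *-cancelˡ-≡ (+ 24) _ _ (begin
  + 24 * + f (0 ∷ 1 ∷ 1 ∷ 0 ∷ []) (5 ℕ.+ a)
    ≡⟨ cong (λ k → + 24 * + k) (f0110≡∑∑∑ a) ⟩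
  + 24 * + ∑ (4 ℕ.+ a) (λ z → suc z ℕ.* ∑ z (λ y → ∑ y (oneDescentFrom a)))
    ≡⟨ 24∑∑∑≡Φ₃ a (oneDescentFrom a) (oneDescentFrom-suc a) ⟩
  Φ₃ (+ oneDescentFrom a 0 + P) P (+ (3 ℕ.+ a)) (+ 1)
    ≡⟨ cong (λ U → Φ₃ (U + P) P (+ (3 ℕ.+ a)) (+ 1)) eulerian ⟩
  Φ₃ (P - + 2 - + a + P) P (+ (3 ℕ.+ a)) (+ 1)
    ≡⟨ 24×rhs≡Φ₃ a ⟨
  _ ∎)
  where
  P : ℤ
  P = + (2 ^ suc a)
  eulerian : + oneDescentFrom a 0 ≡ P - + 2 - + a
  eulerian = x+y≡z⇒x≡z-y (+ a) (x+y≡z⇒x≡z-y (+ 2) (cong +_ (oneDescentFrom-zero a)))
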